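{- Let $\sigma>1$ be an integer, $G$ a matrix with column set $E$, and $\mathbb{A}$ a finite group, in the setting described in the context. For $k=0,\dots,\sigma-1$ let $\mathcal{M}_{1,-1}(k,\sigma)$ be the set of pairs $(f,g)$ of functions $f,g:E\to\mathbb{A}$ such that $f-g$ is a flow of $G$ over $\mathbb{A}$ and $|\mathrm{supp}(f)|-|\mathrm{supp}(g)|\equiv k\pmod\sigma$. Then for every $k$, $|\mathcal{M}_{1,-1}(k,\sigma)|=|\mathcal{M}_{1,-1}(\sigma-k,\sigma)|$, where $\sigma-k$ is read modulo $\sigma$.
   Context: Setting (the paper's hypothesis "$G$ is a totally-$\mathbb{P}$ matrix and $\mathbb{A}$ a $\mathbb{P}$-module", read as the following cases): either (i) $G$ is the vertex–edge or cycle–edge matrix of a graph with edge set $E$, or a totally unimodular matrix, and $\mathbb{A}$ is a finite Abelian group; or (ii) $G$ is a matrix over $\mathrm{GF}(p^s)$ and $\mathbb{A}=\mathrm{GF}(p^s)^d$. With $H$ a matrix orthogonally dual to $G$ (same columns, rows of $H$ orthogonal to rows of $G$, ranks summing to $|E|$; integer in case (i)), a flow of $G$ over $\mathbb{A}$ is $h:E\to\mathbb{A}$ with $Hh^T=0$. $\mathrm{supp}(f)=\{e: f(e)\ne0\}$. -}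

module Defs where

open import Level using (0ℓ)
open import Data.Nat as ℕ using (ℕ; zero; suc)
open import Data.Fin using (Fin; zero; suc; punchIn)
open import Data.Fin.Properties using (all?; any?)
open import Data.Integer as ℤ using (ℤ; +_; 0ℤ; 1ℤ; -1ℤ)
open import Data.Integer.Divisibility.Signed using (_∣_; _∣?_)
open import Data.List using (List; []; _∷_; map; concatMap; length; filter; cartesianProduct)
open import Data.List.Membership.Propositional using (_∈_)
open import Data.List.Relation.Unary.Unique.Propositional using (Unique)
open import Data.Product using (_×_; _,_; proj₁; proj₂; ∃; ∃₂)
open import Data.Sum using (_⊎_)
open import Function.Definitions using (Injective)
open import Relation.Binary.PropositionalEquality using (_≡_; _≢_)
open import Relation.Binary.Definitions using (DecidableEquality)
open import Relation.Nullary using (Dec; ¬?)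
open import Relation.Nullary.Decidable using (_×-dec_)
open import Relation.Unary using (Decidable)
open import Algebra.Structures using (IsAbelianGroup; IsCommutativeRing)

sumF : {R : Set} → (R → R → R) → R → {n : ℕ} → (Fin n → R) → R
sumF _+_ 0# {zero}  f = 0#
sumF _+_ 0# {suc n} f = f zero + sumF _+_ 0# (λ i → f (suc i))

altSign : {R : Set} → (R → R) → ℕ → R → R
altSign neg zero    x = x
altSign neg (suc j) x = neg (altSign neg j x)

det : {R : Set} (_+_ _*_ : R → R → R) (neg : R → R) (0# 1# : R) →
      (n : ℕ) → (Fin n → Fin n → R) → R
det _+_ _*_ neg 0# 1# zero    M = 1#
det _+_ _*_ neg 0# 1# (suc n) M =
  sumF _+_ 0# (λ j → altSign neg (Data.Fin.toℕ j)
    (M zero j * det _+_ _*_ neg 0# 1# n (λ a b → M (suc a) (punchIn j b))))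

sub : {R : Set} {m n k : ℕ} → (Fin m → Fin n → R) →
      (Fin k → Fin m) → (Fin k → Fin n) → Fin k → Fin k → R
sub M r c a b = M (r a) (c b)

HasRank : {R : Set} (_+_ _*_ : R → R → R) (neg : R → R) (0# 1# : R) →
          {m n : ℕ} → (Fin m → Fin n → R) → ℕ → Set
HasRank _+_ _*_ neg 0# 1# {m} {n} M r =
  (∃₂ λ (rs : Fin r → Fin m) (cs : Fin r → Fin n) →
      Injective _≡_ _≡_ rs × Injective _≡_ _≡_ cs ×
      det _+_ _*_ neg 0# 1# r (sub M rs cs) ≢ 0#)
  × (∀ (rs : Fin (suc r) → Fin m) (cs : Fin (suc r) → Fin n) →
      Injective _≡_ _≡_ rs → Injective _≡_ _≡_ cs →
      det _+_ _*_ neg 0# 1# (suc r) (sub M rs cs) ≡ 0#)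

OrthDual : {R : Set} (_+_ _*_ : R → R → R) (neg : R → R) (0# 1# : R) →
           {m m′ n : ℕ} → (Fin m → Fin n → R) → (Fin m′ → Fin n → R) → Set
OrthDual _+_ _*_ neg 0# 1# {m} {m′} {n} G H =
  (∀ i j → sumF _+_ 0# (λ e → G i e * H j e) ≡ 0#)
  × (∃₂ λ a b → HasRank _+_ _*_ neg 0# 1# G a × HasRank _+_ _*_ neg 0# 1# H b
                × a ℕ.+ b ≡ n)

detℤ : (n : ℕ) → (Fin n → Fin n → ℤ) → ℤ
detℤ = det ℤ._+_ ℤ._*_ ℤ.-_ 0ℤ 1ℤ

TotallyUnimodular : {m n : ℕ} → (Fin m → Fin n → ℤ) → Set
TotallyUnimodular {m} {n} M =
  ∀ k (rs : Fin k → Fin m) (cs : Fin k → Fin n) →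
  Injective _≡_ _≡_ rs → Injective _≡_ _≡_ cs →
  detℤ k (sub M rs cs) ≡ 0ℤ ⊎ detℤ k (sub M rs cs) ≡ 1ℤ ⊎ detℤ k (sub M rs cs) ≡ -1ℤ

OrthDualℤ : {m m′ n : ℕ} → (Fin m → Fin n → ℤ) → (Fin m′ → Fin n → ℤ) → Set
OrthDualℤ = OrthDual ℤ._+_ ℤ._*_ ℤ.-_ 0ℤ 1ℤ

record FiniteAbelianGroup : Set₁ where
  field
    Carrier        : Set
    _+_            : Carrier → Carrier → Carrier
    0#             : Carrier
    -_             : Carrier → Carrier
    isAbelianGroup : IsAbelianGroup _≡_ _+_ 0# -_
    _≟_            : DecidableEquality Carrier
    elements       : List Carrier
    complete       : ∀ x → x ∈ elements
    unique         : Unique elements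

  _-_ : Carrier → Carrier → Carrier
  x - y = x + (- y)

  _×ₙ_ : ℕ → Carrier → Carrier
  zero  ×ₙ x = 0#
  suc n ×ₙ x = x + (n ×ₙ x)

  _·_ : ℤ → Carrier → Carrier
  (ℤ.+ n)    · x = n ×ₙ x
  (ℤ.-[1+ n ]) · x = - (suc n ×ₙ x)

record FiniteField : Set₁ where
  field
    Carrier  : Set
    _+_ _*_  : Carrier → Carrier → Carrier
    -_       : Carrier → Carrier
    0# 1#    : Carrier
    isCommutativeRing : IsCommutativeRing _≡_ _+_ _*_ -_ 0# 1#
    0≢1      : 0# ≢ 1#
    inverse  : ∀ x → x ≢ 0# → ∃ λ y → x * y ≡ 1#
    _≟_      : DecidableEquality Carrier
    elements : List Carrier
    complete : ∀ x → x ∈ elements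
    unique   : Unique elements

consF : {A : Set} {n : ℕ} → A → (Fin n → A) → Fin (suc n) → A
consF x f zero    = x
consF x f (suc i) = f i

allFuns : {A : Set} → List A → (n : ℕ) → List (Fin n → A)
allFuns xs zero    = (λ ()) ∷ []
allFuns xs (suc n) = concatMap (λ x → map (consF x) (allFuns xs n)) xs

suppSize : {A : Set} {Z : A → Set} → Decidable Z → {n : ℕ} → (Fin n → A) → ℕ
suppSize Z? {n} f = length (filter (λ e → ¬? (Z? (f e))) (Data.List.allFin n))

InM : {A : Set} {Z : A → Set} (Z? : Decidable Z) (_-_ : A → A → A) {n : ℕ}
      (Flow : (Fin n → A) → Set) (σ : ℕ) (k : ℤ) → (Fin n → A) × (Fin n → A) → Set
InM Z? _-_ Flow σ k (f , g) =
  Flow (λ e → f e - g e) ×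
  (+ σ) ∣ ((+ suppSize Z? f ℤ.- + suppSize Z? g) ℤ.- k)

InM? : {A : Set} {Z : A → Set} (Z? : Decidable Z) (_-_ : A → A → A) {n : ℕ}
       {Flow : (Fin n → A) → Set} → Decidable Flow → (σ : ℕ) (k : ℤ) →
       Decidable (InM Z? _-_ Flow σ k)
InM? Z? _-_ Flow? σ k (f , g) =
  Flow? (λ e → f e - g e) ×-dec
  ((+ σ) ∣? ((+ suppSize Z? f ℤ.- + suppSize Z? g) ℤ.- k))

cardM : {A : Set} (elems : List A) {Z : A → Set} (Z? : Decidable Z)
        (_-_ : A → A → A) (n : ℕ) {Flow : (Fin n → A) → Set} →
        Decidable Flow → (σ : ℕ) (k : ℤ) → ℕ
cardM elems Z? _-_ n Flow? σ k =
  length (filter (InM? Z? _-_ Flow? σ k)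
                 (cartesianProduct (allFuns elems n) (allFuns elems n)))

module _ (𝔸 : FiniteAbelianGroup) where
  open FiniteAbelianGroup 𝔸

  IsFlowGrp : {m′ n : ℕ} → (Fin m′ → Fin n → ℤ) → (Fin n → Carrier) → Set
  IsFlowGrp H h = ∀ j → sumF _+_ 0# (λ e → H j e · h e) ≡ 0#

  IsFlowGrp? : {m′ n : ℕ} (H : Fin m′ → Fin n → ℤ) → Decidable (IsFlowGrp H)
  IsFlowGrp? H h = all? (λ j → sumF _+_ 0# (λ e → H j e · h e) ≟ 0#)

  cardMGrp : {m′ : ℕ} (n : ℕ) → (Fin m′ → Fin n → ℤ) → (σ : ℕ) → ℤ → ℕ
  cardMGrp n H = cardM elements (_≟ 0#) _-_ n (IsFlowGrp? H)

module _ (𝔽 : FiniteField) (d : ℕ) where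
  open FiniteField 𝔽

  Vecᵈ : Set
  Vecᵈ = Fin d → Carrier

  IsZeroV : Vecᵈ → Set
  IsZeroV v = ∀ t → v t ≡ 0#

  IsZeroV? : Decidable IsZeroV
  IsZeroV? v = all? (λ t → v t ≟ 0#)

  _-ᵥ_ : Vecᵈ → Vecᵈ → Vecᵈ
  (u -ᵥ v) t = u t + (- (v t))

  IsFlowFld : {m′ n : ℕ} → (Fin m′ → Fin n → Carrier) → (Fin n → Vecᵈ) → Set
  IsFlowFld H h = ∀ j t → sumF _+_ 0# (λ e → H j e * h e t) ≡ 0#

  IsFlowFld? : {m′ n : ℕ} (H : Fin m′ → Fin n → Carrier) → Decidable (IsFlowFld H)
  IsFlowFld? H h = all? (λ j → all? (λ t → sumF _+_ 0# (λ e → H j e * h e t) ≟ 0#))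

  OrthDualF : {m m′ n : ℕ} → (Fin m → Fin n → Carrier) → (Fin m′ → Fin n → Carrier) → Set
  OrthDualF = OrthDual _+_ _*_ -_ 0# 1#

  cardMFld : {m′ : ℕ} (n : ℕ) → (Fin m′ → Fin n → Carrier) → (σ : ℕ) → ℤ → ℕ
  cardMFld n H = cardM (allFuns elements d) IsZeroV? _-ᵥ_ n (IsFlowFld? H)

module Submission where

-- The transposition (f , g) ↦ (g , f) maps M_{1,-1}(k,σ)
-- bijectively onto M_{1,-1}(σ-k,σ):
--   * g - f = -(f - g), and the flows of H are the kernel of the additive map
--     h ↦ H hᵀ, so they are closed under negation;
--   * |supp g| - |supp f| = -(|supp f| - |supp g|) ≡ -k ≡ σ - k (mod σ).

open import Defs
open import Data.Nat using (ℕ; _<_)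
open import Data.Fin using (Fin)
open import Data.Integer using (ℤ; +_; _-_)
open import Data.Product using (_×_)
open import Relation.Binary.PropositionalEquality using (_≡_)

open import Level using (0ℓ)
open import Data.Nat as ℕ using (zero; suc)
open import Data.Nat.Properties using (+-commutativeSemigroup)
open import Algebra.Properties.CommutativeSemigroup +-commutativeSemigroup using (interchange)
import Data.Integer as ℤ
open import Data.Integer.Divisibility.Signed using (_∣_; ∣m⇒∣-m; ∣m∣n⇒∣m-n; ∣-refl)
open import Data.Integer.Tactic.RingSolver using (solve-∀)
open import Data.Fin using (zero; suc)
open import Data.List using (List; []; _∷_; _++_; map; length; filter; cartesianProduct)
open import Data.List.Properties using (filter-++; length-++)
open import Data.Product using (_,_)
open import Data.Bool using (true; false; if_then_else_)
open import Data.Empty using (⊥-elim)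
open import Function.Bundles using (_⇔_; mk⇔; Equivalence)
open import Relation.Nullary using (yes; no; does)
open import Relation.Unary using (Decidable; Pred)
open import Relation.Binary.PropositionalEquality using (refl; sym; trans; cong; cong₂; subst; module ≡-Reasoning)
open import Algebra.Structures using (IsAbelianGroup)
open import Algebra.Bundles using (AbelianGroup; CommutativeRing)

module _ {X : Set} where

  sumOver : List X → (X → ℕ) → ℕ
  sumOver []       w = 0
  sumOver (x ∷ xs) w = w x ℕ.+ sumOver xs w

  sumOver-cong : (xs : List X) {v w : X → ℕ} → (∀ x → v x ≡ w x) → sumOver xs v ≡ sumOver xs w
  sumOver-cong []       v≡w = refl
  sumOver-cong (x ∷ xs) v≡w = cong₂ ℕ._+_ (v≡w x) (sumOver-cong xs v≡w)

  sumOver-zero : (xs : List X) → sumOver xs (λ _ → 0) ≡ 0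
  sumOver-zero []       = refl
  sumOver-zero (x ∷ xs) = sumOver-zero xs

  sumOver-+ : (xs : List X) (v w : X → ℕ) →
              sumOver xs (λ x → v x ℕ.+ w x) ≡ sumOver xs v ℕ.+ sumOver xs w
  sumOver-+ []       v w = refl
  sumOver-+ (x ∷ xs) v w =
    trans (cong (v x ℕ.+ w x ℕ.+_) (sumOver-+ xs v w))
          (interchange (v x) (w x) (sumOver xs v) (sumOver xs w))

sumOver-comm : {X Y : Set} (xs : List X) (ys : List Y) (w : X → Y → ℕ) →
               sumOver xs (λ x → sumOver ys (w x)) ≡ sumOver ys (λ y → sumOver xs (λ x → w x y))
sumOver-comm []       ys w = sym (sumOver-zero ys)
sumOver-comm (x ∷ xs) ys w =
  trans (cong (sumOver ys (w x) ℕ.+_) (sumOver-comm xs ys w))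
        (sym (sumOver-+ ys (w x) (λ y → sumOver xs (λ x′ → w x′ y))))

indicator : {X : Set} {P : Pred X 0ℓ} → Decidable P → X → ℕ
indicator P? x = if does (P? x) then 1 else 0

indicator-⇔ : {X Y : Set} {P : Pred X 0ℓ} {Q : Pred Y 0ℓ} (P? : Decidable P) (Q? : Decidable Q)
              {a : X} {b : Y} → P a ⇔ Q b → indicator P? a ≡ indicator Q? b
indicator-⇔ P? Q? {a} {b} P⇔Q with P? a | Q? b
... | yes _ | yes _ = refl
... | no  _ | no  _ = refl
... | yes p | no ¬q = ⊥-elim (¬q (Equivalence.to P⇔Q p))
... | no ¬p | yes q = ⊥-elim (¬p (Equivalence.from P⇔Q q))

count-cartesian : {X Y : Set} {P : Pred (X × Y) 0ℓ} (P? : Decidable P) (xs : List X) (ys : List Y) →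
                  length (filter P? (cartesianProduct xs ys))
                    ≡ sumOver xs (λ x → sumOver ys (λ y → indicator P? (x , y)))
count-cartesian P? []       ys = refl
count-cartesian P? (x ∷ xs) ys = begin
  length (filter P? (map (x ,_) ys ++ cartesianProduct xs ys))
    ≡⟨ cong length (filter-++ P? (map (x ,_) ys) (cartesianProduct xs ys)) ⟩
  length (filter P? (map (x ,_) ys) ++ filter P? (cartesianProduct xs ys))
    ≡⟨ length-++ (filter P? (map (x ,_) ys)) ⟩
  length (filter P? (map (x ,_) ys)) ℕ.+ length (filter P? (cartesianProduct xs ys))
    ≡⟨ cong₂ ℕ._+_ (count-row ys) (count-cartesian P? xs ys) ⟩
  sumOver (x ∷ xs) (λ x′ → sumOver ys (λ y → indicator P? (x′ , y))) ∎
  where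
  open ≡-Reasoning
  count-row : ∀ ys → length (filter P? (map (x ,_) ys)) ≡ sumOver ys (λ y → indicator P? (x , y))
  count-row []       = refl
  count-row (y ∷ ys) with does (P? (x , y))
  ... | true  = cong suc (count-row ys)
  ... | false = count-row ys

count-transpose : {X : Set} {P Q : Pred (X × X) 0ℓ} (P? : Decidable P) (Q? : Decidable Q) →
                  (∀ a b → P (a , b) ⇔ Q (b , a)) → (xs : List X) →
                  length (filter P? (cartesianProduct xs xs)) ≡ length (filter Q? (cartesianProduct xs xs))
count-transpose P? Q? P⇔Qᵀ xs = begin
  length (filter P? (cartesianProduct xs xs))
    ≡⟨ count-cartesian P? xs xs ⟩
  sumOver xs (λ a → sumOver xs (λ b → indicator P? (a , b)))
    ≡⟨ sumOver-comm xs xs (λ a b → indicator P? (a , b)) ⟩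
  sumOver xs (λ b → sumOver xs (λ a → indicator P? (a , b)))
    ≡⟨ sumOver-cong xs (λ b → sumOver-cong xs (λ a → indicator-⇔ P? Q? (P⇔Qᵀ a b))) ⟩
  sumOver xs (λ b → sumOver xs (λ a → indicator Q? (b , a)))
    ≡⟨ count-cartesian Q? xs xs ⟨
  length (filter Q? (cartesianProduct xs xs)) ∎
  where open ≡-Reasoning

-- If a - b ≡ k (mod σ) then b - a ≡ σ - k (mod σ), since the two
-- differences-from-target add up to -σ.
residue-transpose : (σ a b k : ℤ) → σ ∣ (a ℤ.- b) ℤ.- k → σ ∣ (b ℤ.- a) ℤ.- (σ ℤ.- k)
residue-transpose σ a b k σ∣ = subst (σ ∣_) (identity σ a b k) (∣m∣n⇒∣m-n (∣m⇒∣-m σ∣) ∣-refl)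
  where
  identity : ∀ σ a b k → ℤ.- ((a ℤ.- b) ℤ.- k) ℤ.- σ ≡ (b ℤ.- a) ℤ.- (σ ℤ.- k)
  identity = solve-∀

-- The converse: transposing again with σ - k in place of k, as σ - (σ - k) = k.
residue-transpose⁻¹ : (σ a b k : ℤ) → σ ∣ (b ℤ.- a) ℤ.- (σ ℤ.- k) → σ ∣ (a ℤ.- b) ℤ.- k
residue-transpose⁻¹ σ a b k σ∣ =
  subst (λ k′ → σ ∣ (a ℤ.- b) ℤ.- k′) (double-reflection σ k) (residue-transpose σ b a (σ ℤ.- k) σ∣)
  where
  double-reflection : ∀ σ k → σ ℤ.- (σ ℤ.- k) ≡ k
  double-reflection = solve-∀

cardM-reflect : {A : Set} (elems : List A) {Z : A → Set} (Z? : Decidable Z)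
                (_-ₐ_ : A → A → A) (n : ℕ) {Flow : (Fin n → A) → Set} (Flow? : Decidable Flow) →
                (∀ f g → Flow (λ e → f e -ₐ g e) → Flow (λ e → g e -ₐ f e)) →
                (σ k : ℕ) → cardM elems Z? _-ₐ_ n Flow? σ (+ k) ≡ cardM elems Z? _-ₐ_ n Flow? σ (+ σ - + k)
cardM-reflect elems Z? _-ₐ_ n {Flow} Flow? flow-swap σ k =
  count-transpose (InM? Z? _-ₐ_ Flow? σ (+ k)) (InM? Z? _-ₐ_ Flow? σ (+ σ - + k))
                  membership-transpose (allFuns elems n)
  where
  membership-transpose : ∀ f g → InM Z? _-ₐ_ Flow σ (+ k) (f , g) ⇔ InM Z? _-ₐ_ Flow σ (+ σ - + k) (g , f)
  membership-transpose f g = mk⇔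
    (λ (flow , σ∣) → flow-swap f g flow , residue-transpose  (+ σ) (+ |f|) (+ |g|) (+ k) σ∣)
    (λ (flow , σ∣) → flow-swap g f flow , residue-transpose⁻¹ (+ σ) (+ |f|) (+ |g|) (+ k) σ∣)
    where
    |f| |g| : ℕ
    |f| = suppSize Z? f
    |g| = suppSize Z? g

module NegatedSums {C : Set} (_∙_ : C → C → C) (0# : C) (neg : C → C)
                   (isAbelianGroup : IsAbelianGroup _≡_ _∙_ 0# neg) where

  abelianGroup : AbelianGroup 0ℓ 0ℓ
  abelianGroup = record { isAbelianGroup = isAbelianGroup }

  open import Algebra.Properties.AbelianGroup abelianGroup public
    using (ε⁻¹≈ε; ⁻¹-∙-comm; ⁻¹-anti-homo‿-)

  -- Negation is a homomorphism of an Abelian group, so it commutes with sums.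
  sumF-neg : (n : ℕ) (b : Fin n → C) → sumF _∙_ 0# (λ e → neg (b e)) ≡ neg (sumF _∙_ 0# b)
  sumF-neg zero    b = sym ε⁻¹≈ε
  sumF-neg (suc n) b =
    trans (cong (neg (b zero) ∙_) (sumF-neg n (λ i → b (suc i)))) (⁻¹-∙-comm (b zero) _)

  sumF-cong : (n : ℕ) {a b : Fin n → C} → (∀ e → a e ≡ b e) → sumF _∙_ 0# a ≡ sumF _∙_ 0# b
  sumF-cong zero    a≡b = refl
  sumF-cong (suc n) a≡b = cong₂ _∙_ (a≡b zero) (sumF-cong n (λ i → a≡b (suc i)))

  negated-sum-vanishes : (n : ℕ) (a b : Fin n → C) → (∀ e → a e ≡ neg (b e)) →
                         sumF _∙_ 0# b ≡ 0# → sumF _∙_ 0# a ≡ 0#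
  negated-sum-vanishes n a b a≡-b Σb≡0 = begin
    sumF _∙_ 0# a                 ≡⟨ sumF-cong n a≡-b ⟩
    sumF _∙_ 0# (λ e → neg (b e)) ≡⟨ sumF-neg n b ⟩
    neg (sumF _∙_ 0# b)           ≡⟨ cong neg Σb≡0 ⟩
    neg 0#                        ≡⟨ ε⁻¹≈ε ⟩
    0#                            ∎
    where open ≡-Reasoning

-- Case (i): the ℤ-action on a finite Abelian group commutes with negation,
-- so each row equation of H hᵀ = 0 survives replacing f - g by g - f.
module GroupFlows (𝔸 : FiniteAbelianGroup) where
  open FiniteAbelianGroup 𝔸 hiding (_-_) renaming (-_ to neg)
  open NegatedSums _+_ 0# neg isAbelianGroup

  ×ₙ-neg : ∀ m x → m ×ₙ neg x ≡ neg (m ×ₙ x)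
  ×ₙ-neg zero    x = sym ε⁻¹≈ε
  ×ₙ-neg (suc m) x = trans (cong (λ y → neg x + y) (×ₙ-neg m x)) (⁻¹-∙-comm x _)

  ·-neg : ∀ z x → z · neg x ≡ neg (z · x)
  ·-neg (ℤ.+ m)    x = ×ₙ-neg m x
  ·-neg ℤ.-[1+ m ] x = cong neg (×ₙ-neg (suc m) x)

  flow-swap : {m′ n : ℕ} (H : Fin m′ → Fin n → ℤ) (f g : Fin n → Carrier) →
              IsFlowGrp 𝔸 H (λ e → f e + neg (g e)) → IsFlowGrp 𝔸 H (λ e → g e + neg (f e))
  flow-swap {n = n} H f g flow j = negated-sum-vanishes n _ _ term-neg (flow j)
    where
    term-neg : ∀ e → H j e · (g e + neg (f e)) ≡ neg (H j e · (f e + neg (g e)))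
    term-neg e = trans (cong (H j e ·_) (sym (⁻¹-anti-homo‿- (f e) (g e)))) (·-neg (H j e) _)

-- Case (ii): over F^d, coordinatewise, using h · (-x) = -(h · x) in the field F.
module FieldFlows (𝔽 : FiniteField) (d : ℕ) where
  open FiniteField 𝔽 renaming (-_ to neg)

  commutativeRing : CommutativeRing 0ℓ 0ℓ
  commutativeRing = record { isCommutativeRing = isCommutativeRing }

  open CommutativeRing commutativeRing using (+-isAbelianGroup; ring)
  open import Algebra.Properties.Ring ring using (-‿distribʳ-*)
  open NegatedSums _+_ 0# neg +-isAbelianGroup

  flow-swap : {m′ n : ℕ} (H : Fin m′ → Fin n → Carrier) (f g : Fin n → Vecᵈ 𝔽 d) →
              IsFlowFld 𝔽 d H (λ e → _-ᵥ_ 𝔽 d (f e) (g e)) → IsFlowFld 𝔽 d H (λ e → _-ᵥ_ 𝔽 d (g e) (f e))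
  flow-swap {n = n} H f g flow j t = negated-sum-vanishes n _ _ term-neg (flow j t)
    where
    term-neg : ∀ e → H j e * (g e t + neg (f e t)) ≡ neg (H j e * (f e t + neg (g e t)))
    term-neg e = trans (cong (H j e *_) (sym (⁻¹-anti-homo‿- (f e t) (g e t))))
                       (sym (-‿distribʳ-* (H j e) _))

proposition4p9 :
    (∀ (𝔸 : FiniteAbelianGroup) (m m′ n : ℕ)
       (G : Fin m → Fin n → ℤ) (H : Fin m′ → Fin n → ℤ) →
       TotallyUnimodular G → OrthDualℤ G H →
       (σ : ℕ) → 1 < σ → (k : ℕ) → k < σ →
       cardMGrp 𝔸 n H σ (+ k) ≡ cardMGrp 𝔸 n H σ (+ σ - + k))
    ×
    (∀ (𝔽 : FiniteField) (d m m′ n : ℕ)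
       (G : Fin m → Fin n → FiniteField.Carrier 𝔽)
       (H : Fin m′ → Fin n → FiniteField.Carrier 𝔽) →
       OrthDualF 𝔽 d G H →
       (σ : ℕ) → 1 < σ → (k : ℕ) → k < σ →
       cardMFld 𝔽 d n H σ (+ k) ≡ cardMFld 𝔽 d n H σ (+ σ - + k))
proposition4p9 =
  (λ 𝔸 m m′ n G H _ _ σ _ k _ →
     let open FiniteAbelianGroup 𝔸 using (elements; _≟_; 0#) in
     cardM-reflect elements (_≟ 0#) (FiniteAbelianGroup._-_ 𝔸) n
                   (IsFlowGrp? 𝔸 H) (GroupFlows.flow-swap 𝔸 H) σ k)
  ,
  (λ 𝔽 d m m′ n G H _ σ _ k _ →
     cardM-reflect (allFuns (FiniteField.elements 𝔽) d) (IsZeroV? 𝔽 d) (_-ᵥ_ 𝔽 d) n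
                   (IsFlowFld? 𝔽 d H) (FieldFlows.flow-swap 𝔽 d H) σ k)
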